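{- For every $n\ge2$, the map $\phi$ defined below is a bijection of $\mathrm{And}_n^{I}$ onto $\mathrm{And}_n^{II}$, and for every $w\in\mathrm{And}_n^{I}$, $(\mathbf{F}\,w,\ \mathbf{spi}\,w,\ \mathbf{NL}\,w)=(\mathbf{pit}\,\phi(w),\ \mathbf{L}\,\phi(w),\ \mathbf{grn}\,\phi(w))$.
   Context: Words $w=x_1\cdots x_n$ are permutations of finite sets $X$ of positive integers. Andr\'e permutations: the empty word $e$ and one-letter words are Andr\'e I and II; for $|X|\ge2$ write $w=v\,\min(w)\,v'$; $w$ is Andr\'e I (resp. II) if $v,v'$ are Andr\'e I (resp. II) and $\max(vv')$ (resp. $\min(vv')$) is a letter of $v'$. $\mathrm{And}_X^{I}$ etc.; $\mathrm{And}_n^{I}$, $\mathrm{And}_n^{II}$ for $X=\{1,\dots,n\}$. Statistics ($n\ge2$): $\mathbf{F}\,w=x_1$; $\mathbf{L}\,w=x_n$; $\mathbf{NL}\,w=x_{n-1}$; $\mathbf{grn}\,w=\max\{x_{i-1},x_{i+1}\}$ where $x_i$ is the maximum letter, with $x_0=x_{n+1}=0$; $\mathbf{spi}\,w$ is the letter $x_i$ such that $x_1\le x_j$ for all $j\le i$ and $x_1>x_{i+1}$ (convention $x_{n+1}=0$); $\mathbf{pit}\,w$, for words with $x_{n-1}<x_n$: if $w$ ends with its maximum letter, $\mathbf{pit}\,w=\min(w)$; otherwise write $w=w_1\,\min(w)\,w_2$ and set $\mathbf{pit}\,w=\mathbf{pit}\,w_2$. Definition of $\phi$ on $\mathrm{And}_X^{I}$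 (recursive), where $X=\{a_1<a_2<\cdots<a_n\}$: $\phi(e)=e$, $\phi(a_1)=a_1$, $\phi(a_1a_2)=a_1a_2$. For $n\ge3$, each $w\in\mathrm{And}_X^I$ has either the form (i) $w=v_0\,a_1\,v_1\,a_2\,v_2$ or (ii) $w=v_0\,a_2\,v_2\,a_1\,v_1$ with factors $v_0,v_1,v_2$ (possibly empty words); in both cases $\phi(w)=\phi(v_1)\,a_1\,\phi(v_0\,a_2\,v_2)$. -}

module Defs where

open import Data.Nat using (ℕ; zero; suc; _≤_; _<_; _⊔_; _⊓_; _≤ᵇ_; _≡ᵇ_)
open import Data.Bool using (Bool; true; false; if_then_else_)
open import Data.List using (List; []; _∷_; _++_; foldr; length; applyUpTo; reverse)
open import Data.Bool.ListAction using (any)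
open import Data.List.Relation.Unary.All using (All)
open import Data.List.Membership.Propositional using (_∈_)
open import Data.List.Relation.Binary.Permutation.Propositional using (_↭_)
open import Data.Product using (_×_; _,_; ∃-syntax; proj₁; proj₂)

-- Words are lists of positive integers (letters).

-- maximum letter (0 for the empty word; letters are positive)
maxL : List ℕ → ℕ
maxL = foldr _⊔_ 0

-- minimum letter (0 for the empty word, never used there)
minL : List ℕ → ℕ
minL []       = 0
minL (x ∷ xs) = foldr _⊓_ x xs

splitOn : ℕ → List ℕ → List ℕ × List ℕ
splitOn a [] = [] , []
splitOn a (x ∷ xs) with x ≡ᵇ a
... | true  = [] , xs
... | false = x ∷ proj₁ (splitOn a xs) , proj₂ (splitOn a xs)

-- Andre permutations of type I and II (recursive definition, w = v min(w) v')
data AndI : List ℕ → Set where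
  andI-[]     : AndI []
  andI-single : ∀ x → AndI (x ∷ [])
  andI-split  : ∀ {v m v'} → All (m <_) (v ++ v') → AndI v → AndI v' →
                (∃[ x ] (x ∈ v' × All (_≤ x) (v ++ v'))) →
                AndI (v ++ m ∷ v')

data AndII : List ℕ → Set where
  andII-[]     : AndII []
  andII-single : ∀ x → AndII (x ∷ [])
  andII-split  : ∀ {v m v'} → All (m <_) (v ++ v') → AndII v → AndII v' →
                 (∃[ x ] (x ∈ v' × All (x ≤_) (v ++ v'))) →
                 AndII (v ++ m ∷ v')

[1‥_] : ℕ → List ℕ
[1‥ n ] = applyUpTo suc n

AndIn : ℕ → List ℕ → Set
AndIn n w = (w ↭ [1‥ n ]) × AndI w

AndIIn : ℕ → List ℕ → Set
AndIIn n w = (w ↭ [1‥ n ]) × AndII w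

-- The map φ, with fuel (fuel = length w suffices, each call shrinks the word).
φ' : ℕ → List ℕ → List ℕ
φ' zero w = w
φ' (suc f) [] = []
φ' (suc f) (x ∷ []) = x ∷ []
φ' (suc f) (x ∷ y ∷ []) = x ∷ y ∷ []
φ' (suc f) w@(x ∷ y ∷ z ∷ r) =
  let a1  = minL w
      v0' = proj₁ (splitOn a1 w)
      v1' = proj₂ (splitOn a1 w)
      a2  = minL (v0' ++ v1')
  in if any (_≡ᵇ a2) v1'
     -- case (i): w = v0 a1 v1 a2 v2 with v0 = v0', v1' = v1 a2 v2
     then φ' f (proj₁ (splitOn a2 v1')) ++ a1 ∷ φ' f (v0' ++ a2 ∷ proj₂ (splitOn a2 v1'))
     -- case (ii): w = v0 a2 v2 a1 v1 with v0' = v0 a2 v2, v1 = v1'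
     else φ' f v1' ++ a1 ∷ φ' f v0'

φ : List ℕ → List ℕ
φ w = φ' (length w) w

-- Statistics (default value 0 on too-short words)
headD : List ℕ → ℕ
headD []      = 0
headD (x ∷ _) = x

F : List ℕ → ℕ
F = headD

L : List ℕ → ℕ
L w = headD (reverse w)

NL : List ℕ → ℕ
NL w with reverse w
... | _ ∷ y ∷ _ = y
... | _         = 0

-- greater neighbour of the maximum letter (x_0 = x_{n+1} = 0)
grn : List ℕ → ℕ
grn w = L (proj₁ (splitOn (maxL w) w)) ⊔ headD (proj₂ (splitOn (maxL w) w))

spiGo : ℕ → ℕ → List ℕ → ℕ
spiGo x1 cur []       = cur
spiGo x1 cur (y ∷ ys) = if x1 ≤ᵇ y then spiGo x1 y ys else cur

spi : List ℕ → ℕ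
spi []       = 0
spi (x ∷ xs) = spiGo x x xs

pit' : ℕ → List ℕ → ℕ
pit' zero    w = minL w
pit' (suc f) w = if L w ≡ᵇ maxL w then minL w else pit' f (proj₂ (splitOn (minL w) w))

pit : List ℕ → ℕ
pit w = pit' (length w) w

-- Write an André I word w of length at least 2 in form (i) or (ii) and put a = a₁,
-- t₁ = v₁ and t₂ = v₀ a₂ v₂, so that φ w = φ t₁ a φ t₂. The parts are shorter André I
-- words, a lies below both, and the minimum a₂ of t₂ lies below t₁; w is recovered from
-- (a, t₁, t₂), being of form (i) exactly when max t₁ < max t₂, and every such triple
-- arises. An André II word u₁ a u₂ split at its minimum satisfies the same conditions
-- (with min u₂ below u₁), so induction on the length makes φ a bijection.
-- The statistics follow the same recursion: spi w = spi t₂ while φ w and φ t₂ end alike;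
-- pit removes a from φ w and continues in φ t₂, unless φ w ends with its maximum, which
-- happens exactly when w starts with its minimum (and then F w = a); and the maximum of
-- φ w keeps its larger neighbour from the image of the part containing max w, whose
-- next-to-last letter is that of w.

module Submission where

open import Defs
open import Data.Nat using (ℕ; _≤_)
open import Data.List using (List)
open import Data.Product using (_×_; ∃-syntax)
open import Relation.Binary.PropositionalEquality using (_≡_)

open import Data.Nat using (zero; suc; _+_; _<_; _⊔_; _⊓_; _≤ᵇ_; _≡ᵇ_; z≤n; s≤s; s≤s⁻¹; _<?_; _≟_)
open import Data.Nat.Properties
open import Data.Bool using (true; false; T; if_then_else_)
open import Data.Bool.Properties using (T-≡)
open import Data.Bool.ListAction using (any)
open import Data.Empty using (⊥; ⊥-elim)
open import Data.List using ([]; _∷_; _++_; foldr; length; reverse; [_]; _∷ʳ_)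
open import Data.List.Properties
  using (++-assoc; ++-conicalˡ; ++-conicalʳ; length-++; reverse-++; unfold-reverse; length-reverse; length-applyUpTo)
open import Data.List.Relation.Unary.All as All using (All; []; _∷_)
import Data.List.Relation.Unary.All.Properties as All
open import Data.List.Relation.Unary.All.Properties.Core using (¬All⇒Any¬)
open import Data.List.Relation.Unary.Any as Any using (here; there)
open import Data.List.Relation.Unary.Any.Properties using (any⁺; any⁻)
open import Data.List.Membership.Propositional using (_∈_; _∉_; find)
open import Data.List.Membership.Propositional.Properties using (∈-++⁺ˡ; ∈-++⁺ʳ; ∈-++⁻)
open import Data.List.Relation.Binary.Permutation.Propositional as ↭ using (_↭_; ↭-sym; ↭-trans; ↭⇒↭ₛ)
open import Data.List.Relation.Binary.Permutation.Propositional.Properties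
  using (All-resp-↭; ∈-resp-↭; ↭-length; ++-comm; shift; shifts) renaming (++⁺ to ↭-++⁺)
open import Data.List.Relation.Unary.Unique.Propositional using (Unique; []; _∷_)
import Data.List.Relation.Unary.AllPairs as AllPairs
open import Data.List.Relation.Unary.Unique.Propositional.Properties using (applyUpTo⁺₁)
open import Data.Product using (_,_; proj₁; proj₂; ∃₂)
open import Data.Sum using (_⊎_; inj₁; inj₂)
open import Function using (_∘_)
open import Function.Bundles using (Equivalence)
open import Relation.Nullary using (¬_; yes; no)
open import Relation.Binary.PropositionalEquality hiding ([_])
open import Data.List.Relation.Binary.Permutation.Setoid.Properties (setoid ℕ) using (Unique-resp-↭)

T⇒≡true : ∀ {b} → T b → b ≡ true
T⇒≡true = Equivalence.to T-≡

¬T⇒≡false : ∀ {b} → ¬ T b → b ≡ false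
¬T⇒≡false {false} _ = refl
¬T⇒≡false {true}  ¬t = ⊥-elim (¬t _)

≡ᵇ-true : ∀ {m n} → m ≡ n → (m ≡ᵇ n) ≡ true
≡ᵇ-true {m} {n} m≡n = T⇒≡true (≡⇒≡ᵇ m n m≡n)

≡ᵇ-false : ∀ {m n} → m ≢ n → (m ≡ᵇ n) ≡ false
≡ᵇ-false {m} {n} m≢n = ¬T⇒≡false (m≢n ∘ ≡ᵇ⇒≡ m n)

any-≡ᵇ-∈ : ∀ {b xs} → b ∈ xs → any (_≡ᵇ b) xs ≡ true
any-≡ᵇ-∈ {b} b∈ = T⇒≡true (any⁺ _ (Any.map (λ {x} b≡x → ≡⇒≡ᵇ x b (sym b≡x)) b∈))

any-≡ᵇ-∉ : ∀ {b xs} → b ∉ xs → any (_≡ᵇ b) xs ≡ false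
any-≡ᵇ-∉ {b} {xs} b∉ = ¬T⇒≡false (b∉ ∘ Any.map (λ {x} → sym ∘ ≡ᵇ⇒≡ x b) ∘ any⁻ _ xs)

∈⇒≢[] : ∀ {x : ℕ} {xs} → x ∈ xs → xs ≢ []
∈⇒≢[] () refl

headD-∈ : ∀ {xs} → xs ≢ [] → headD xs ∈ xs
headD-∈ {[]}    xs≢[] = ⊥-elim (xs≢[] refl)
headD-∈ {_ ∷ _} _     = here refl

<-all⇒∉ : ∀ {a xs} → All (a <_) xs → a ∉ xs
<-all⇒∉ a<xs a∈xs = <-irrefl refl (All.lookup a<xs a∈xs)

<-all⇒≤-all : ∀ {a xs} → All (a <_) xs → All (a ≤_) xs
<-all⇒≤-all = All.map <⇒≤

∈⇒≤maxL : ∀ {x xs} → x ∈ xs → x ≤ maxL xs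
∈⇒≤maxL {xs = y ∷ ys} (here refl) = m≤m⊔n y (maxL ys)
∈⇒≤maxL {xs = y ∷ ys} (there x∈) = ≤-trans (∈⇒≤maxL x∈) (m≤n⊔m y (maxL ys))

maxL-lub : ∀ {m xs} → All (_≤ m) xs → maxL xs ≤ m
maxL-lub []         = z≤n
maxL-lub (x≤ ∷ xs≤) = ⊔-lub x≤ (maxL-lub xs≤)

maxL-<-lub : ∀ {m xs} → 0 < m → All (_< m) xs → maxL xs < m
maxL-<-lub 0<m []         = 0<m
maxL-<-lub 0<m (x< ∷ xs<) = ⊔-lub x< (maxL-<-lub 0<m xs<)

maxL-∈ : ∀ {x xs} → maxL (x ∷ xs) ∈ x ∷ xs
maxL-∈ {x} {[]} = here (⊔-identityʳ x)
maxL-∈ {x} {y ∷ ys} with ⊔-sel x (maxL (y ∷ ys))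
... | inj₁ eq = here eq
... | inj₂ eq = there (subst (_∈ y ∷ ys) (sym eq) maxL-∈)

≢[]⇒maxL-∈ : ∀ {xs} → xs ≢ [] → maxL xs ∈ xs
≢[]⇒maxL-∈ {[]}    xs≢[] = ⊥-elim (xs≢[] refl)
≢[]⇒maxL-∈ {_ ∷ _} _     = maxL-∈

maxL-≡ : ∀ {m xs} → m ∈ xs → All (_≤ m) xs → maxL xs ≡ m
maxL-≡ m∈ ≤m = ≤-antisym (maxL-lub ≤m) (∈⇒≤maxL m∈)

maxL-↭ : ∀ {xs ys} → xs ↭ ys → maxL xs ≡ maxL ys
maxL-↭ {xs} {ys} xs↭ys = ≤-antisym
  (maxL-lub (All.tabulate (∈⇒≤maxL ∘ ∈-resp-↭ xs↭ys)))
  (maxL-lub (All.tabulate (∈⇒≤maxL ∘ ∈-resp-↭ (↭-sym xs↭ys))))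

minL-≤ : ∀ {x xs} → x ∈ xs → minL xs ≤ x
minL-≤ {xs = y ∷ ys} = go ys
  where
    go : ∀ {x y} ys → x ∈ y ∷ ys → foldr _⊓_ y ys ≤ x
    go []       (here refl)         = ≤-refl
    go (z ∷ zs) (here refl)         = ≤-trans (m⊓n≤n z _) (go zs (here refl))
    go (z ∷ zs) (there (here refl)) = m⊓n≤m z _
    go (z ∷ zs) (there (there x∈))  = ≤-trans (m⊓n≤n z _) (go zs (there x∈))

minL-∈ : ∀ {x xs} → minL (x ∷ xs) ∈ x ∷ xs
minL-∈ {x} {[]} = here refl
minL-∈ {x} {y ∷ ys} with ⊓-sel y (minL (x ∷ ys))
... | inj₁ eq = there (here eq)
... | inj₂ eq with minL-∈ {x} {ys}
...   | here e   = here (trans eq e)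
...   | there e∈ = there (there (subst (_∈ ys) (sym eq) e∈))

∈⇒minL-∈ : ∀ {x xs} → x ∈ xs → minL xs ∈ xs
∈⇒minL-∈ {xs = _ ∷ _} _ = minL-∈

minL-≡ : ∀ {m xs} → m ∈ xs → All (m ≤_) xs → minL xs ≡ m
minL-≡ m∈ m≤ = ≤-antisym (minL-≤ m∈) (All.lookup m≤ (∈⇒minL-∈ m∈))

minL-∷ : ∀ {m} xs ys → All (m <_) xs → All (m <_) ys → minL (xs ++ m ∷ ys) ≡ m
minL-∷ xs ys m<xs m<ys = minL-≡ (∈-++⁺ʳ xs (here refl)) (All.++⁺ (<-all⇒≤-all m<xs) (≤-refl ∷ <-all⇒≤-all m<ys))

splitOn-mid : ∀ {a} p s → a ∉ p → splitOn a (p ++ a ∷ s) ≡ (p , s)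
splitOn-mid {a} []      s _   rewrite ≡ᵇ-true (refl {x = a}) = refl
splitOn-mid {a} (x ∷ p) s a∉ rewrite ≡ᵇ-false {x} {a} (a∉ ∘ here ∘ sym) | splitOn-mid p s (a∉ ∘ there) = refl

∈⇒first-occurrence : ∀ {a xs} → a ∈ xs → ∃₂ λ p s → xs ≡ p ++ a ∷ s × a ∉ p
∈⇒first-occurrence {a} {x ∷ xs} a∈ with x ≟ a | a∈
... | yes refl | _ = [] , xs , refl , λ ()
... | no x≢a | here a≡x = ⊥-elim (x≢a (sym a≡x))
... | no x≢a | there a∈xs with ∈⇒first-occurrence a∈xs
...   | p , s , refl , a∉p = x ∷ p , s , refl , λ { (here a≡x) → x≢a (sym a≡x) ; (there a∈p) → a∉p a∈p }

∷-split-injective : ∀ {a} p s p′ s′ → a ∉ p → a ∉ p′ → p ++ a ∷ s ≡ p′ ++ a ∷ s′ → p ≡ p′ × s ≡ s′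
∷-split-injective {a} p s p′ s′ a∉p a∉p′ eq
  with trans (sym (splitOn-mid p s a∉p)) (trans (cong (splitOn a) eq) (splitOn-mid p′ s′ a∉p′))
... | refl = refl , refl

Unique-++⁻ˡ : ∀ xs {ys : List ℕ} → Unique (xs ++ ys) → Unique xs
Unique-++⁻ˡ []       _               = []
Unique-++⁻ˡ (x ∷ xs) (x∉ ∷ xs++ys!) = All.++⁻ˡ xs x∉ ∷ Unique-++⁻ˡ xs xs++ys!

Unique-++⁻ʳ : ∀ xs {ys : List ℕ} → Unique (xs ++ ys) → Unique ys
Unique-++⁻ʳ []       ys!           = ys!
Unique-++⁻ʳ (x ∷ xs) (_ ∷ xs++ys!) = Unique-++⁻ʳ xs xs++ys!

Unique-++-disjoint : ∀ xs {ys : List ℕ} {x} → Unique (xs ++ ys) → x ∈ xs → x ∈ ys → ⊥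
Unique-++-disjoint (x ∷ xs) (x∉ ∷ _)   (here refl) x∈ys = All.lookup (All.++⁻ʳ xs x∉) x∈ys refl
Unique-++-disjoint (x ∷ xs) (_ ∷ xs++ys!) (there x∈xs) x∈ys = Unique-++-disjoint xs xs++ys! x∈xs x∈ys

headD-∷ʳ-++ : ∀ xs (y : ℕ) zs → headD ((xs ∷ʳ y) ++ zs) ≡ headD (xs ∷ʳ y)
headD-∷ʳ-++ []      y zs = refl
headD-∷ʳ-++ (_ ∷ _) y zs = refl

L-++ : ∀ xs y ys → L (xs ++ y ∷ ys) ≡ L (y ∷ ys)
L-++ xs y ys = begin
  headD (reverse (xs ++ y ∷ ys))           ≡⟨ cong headD (reverse-++ xs (y ∷ ys)) ⟩
  headD (reverse (y ∷ ys) ++ reverse xs)   ≡⟨ cong (λ zs → headD (zs ++ reverse xs)) (unfold-reverse y ys) ⟩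
  headD ((reverse ys ∷ʳ y) ++ reverse xs)  ≡⟨ headD-∷ʳ-++ (reverse ys) y (reverse xs) ⟩
  headD (reverse ys ∷ʳ y)                  ≡⟨ cong headD (sym (unfold-reverse y ys)) ⟩
  L (y ∷ ys)                               ∎
  where open ≡-Reasoning

L-++-∷ : ∀ xs a {ys} → ys ≢ [] → L (xs ++ a ∷ ys) ≡ L ys
L-++-∷ xs a {[]}     ys≢[] = ⊥-elim (ys≢[] refl)
L-++-∷ xs a {c ∷ cs} _     = trans (L-++ xs a (c ∷ cs)) (L-++ [ a ] c cs)

L-∈ : ∀ y ys → L (y ∷ ys) ∈ y ∷ ys
L-∈ y []       = here refl
L-∈ y (z ∷ zs) = subst (_∈ y ∷ z ∷ zs) (sym (L-++ [ y ] z zs)) (there (L-∈ z zs))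

secondD : List ℕ → ℕ
secondD (_ ∷ y ∷ _) = y
secondD _           = 0

NL≡secondD-reverse : ∀ w → NL w ≡ secondD (reverse w)
NL≡secondD-reverse w with reverse w
... | []        = refl
... | _ ∷ []    = refl
... | _ ∷ _ ∷ _ = refl

NL-++ : ∀ xs ys → 2 ≤ length ys → NL (xs ++ ys) ≡ NL ys
NL-++ xs ys 2≤ys = begin
  NL (xs ++ ys)                          ≡⟨ NL≡secondD-reverse (xs ++ ys) ⟩
  secondD (reverse (xs ++ ys))           ≡⟨ cong secondD (reverse-++ xs ys) ⟩
  secondD (reverse ys ++ reverse xs)     ≡⟨ secondD-++ (reverse ys) 2≤rev-ys ⟩
  secondD (reverse ys)                   ≡⟨ sym (NL≡secondD-reverse ys) ⟩
  NL ys                                  ∎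
  where
    open ≡-Reasoning
    2≤rev-ys = subst (2 ≤_) (sym (length-reverse ys)) 2≤ys
    secondD-++ : ∀ zs {us} → 2 ≤ length zs → secondD (zs ++ us) ≡ secondD zs
    secondD-++ (_ ∷ _ ∷ _) _          = refl
    secondD-++ (_ ∷ [])    (s≤s ())

spiGo-cut : ∀ {x₁ b} cur r s → b < x₁ → spiGo x₁ cur (r ++ b ∷ s) ≡ spiGo x₁ cur r
spiGo-cut {x₁} {b} cur []      s b<x₁ rewrite ¬T⇒≡false (<⇒≱ b<x₁ ∘ ≤ᵇ⇒≤ x₁ b) = refl
spiGo-cut {x₁}     cur (y ∷ r) s b<x₁ with x₁ ≤ᵇ y
... | true  = spiGo-cut y r s b<x₁
... | false = refl

spiGo-∈ : ∀ {x₁} cur ys → spiGo x₁ cur ys ∈ cur ∷ ys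
spiGo-∈       cur []       = here refl
spiGo-∈ {x₁} cur (y ∷ ys) with x₁ ≤ᵇ y
... | true  = there (spiGo-∈ y ys)
... | false = here refl

spiGo-≥ : ∀ {x₁} cur ys → All (x₁ ≤_) ys → spiGo x₁ cur ys ≡ L (cur ∷ ys)
spiGo-≥       cur []       []              = refl
spiGo-≥ {x₁} cur (y ∷ ys) (x₁≤y ∷ x₁≤ys) rewrite T⇒≡true (≤⇒≤ᵇ x₁≤y) =
  trans (spiGo-≥ y ys x₁≤ys) (sym (L-++ [ cur ] y ys))

spi-cut : ∀ {x b} r s → b < x → spi (x ∷ r ++ b ∷ s) ≡ spi (x ∷ r)
spi-cut {x} = spiGo-cut x

spi-∈ : ∀ x r → spi (x ∷ r) ∈ x ∷ r
spi-∈ x = spiGo-∈ x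

spi-min-head : ∀ {x xs} → All (x ≤_) xs → spi (x ∷ xs) ≡ L (x ∷ xs)
spi-min-head {x} {xs} = spiGo-≥ x xs

grn-split : ∀ p M s → maxL (p ++ M ∷ s) ≡ M → M ∉ p → grn (p ++ M ∷ s) ≡ L p ⊔ headD s
grn-split p M s max≡M M∉p =
  cong (λ (q , r) → L q ⊔ headD r)
       (trans (cong (λ m → splitOn m (p ++ M ∷ s)) max≡M) (splitOn-mid p s M∉p))

grn-++ʳ : ∀ {A M} a B → M ∈ A → maxL A ≡ M → maxL (A ++ a ∷ B) ≡ M →
          All (a <_) A → 2 ≤ length A → grn (A ++ a ∷ B) ≡ grn A
grn-++ʳ {M = M} a B M∈A maxA maxAaB a<A 2≤A with ∈⇒first-occurrence M∈A
... | p , s , refl , M∉p = begin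
  grn ((p ++ M ∷ s) ++ a ∷ B)  ≡⟨ cong grn (++-assoc p (M ∷ s) (a ∷ B)) ⟩
  grn (p ++ M ∷ s ++ a ∷ B)    ≡⟨ grn-split p M (s ++ a ∷ B) maxAaB′ M∉p ⟩
  L p ⊔ headD (s ++ a ∷ B)     ≡⟨ right-neighbour p s a<A 2≤A ⟩
  L p ⊔ headD s                ≡⟨ sym (grn-split p M s maxA M∉p) ⟩
  grn (p ++ M ∷ s)             ∎
  where
    open ≡-Reasoning
    maxAaB′ : maxL (p ++ M ∷ s ++ a ∷ B) ≡ M
    maxAaB′ = trans (cong maxL (sym (++-assoc p (M ∷ s) (a ∷ B)))) maxAaB
    right-neighbour : ∀ p s → All (a <_) (p ++ M ∷ s) → 2 ≤ length (p ++ M ∷ s) →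
                      L p ⊔ headD (s ++ a ∷ B) ≡ L p ⊔ headD s
    right-neighbour p        (_ ∷ _) _   _         = refl
    right-neighbour []       []      _   (s≤s ())
    right-neighbour (q ∷ qs) []      a<A _ =
      trans (m≥n⇒m⊔n≡m (<⇒≤ (All.lookup a<A (∈-++⁺ˡ (L-∈ q qs))))) (sym (⊔-identityʳ _))

grn-++ˡ : ∀ {B M} A a → M ∈ B → maxL B ≡ M → maxL (A ++ a ∷ B) ≡ M →
          All (_< M) A → All (a <_) B → 2 ≤ length B → grn (A ++ a ∷ B) ≡ grn B
grn-++ˡ {M = M} A a M∈B maxB maxAaB A<M a<B 2≤B with ∈⇒first-occurrence M∈B
... | p , s , refl , M∉p = begin
  grn (A ++ a ∷ p ++ M ∷ s)    ≡⟨ cong grn (sym (++-assoc A (a ∷ p) (M ∷ s))) ⟩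
  grn ((A ++ a ∷ p) ++ M ∷ s)  ≡⟨ grn-split (A ++ a ∷ p) M s maxAaB′ M∉Aap ⟩
  L (A ++ a ∷ p) ⊔ headD s     ≡⟨ left-neighbour p s a<B 2≤B ⟩
  L p ⊔ headD s                ≡⟨ sym (grn-split p M s maxB M∉p) ⟩
  grn (p ++ M ∷ s)             ∎
  where
    open ≡-Reasoning
    maxAaB′ : maxL ((A ++ a ∷ p) ++ M ∷ s) ≡ M
    maxAaB′ = trans (cong maxL (++-assoc A (a ∷ p) (M ∷ s))) maxAaB
    M∉Aap : M ∉ A ++ a ∷ p
    M∉Aap M∈ with ∈-++⁻ A M∈
    ... | inj₁ M∈A         = <-irrefl refl (All.lookup A<M M∈A)
    ... | inj₂ (here M≡a)  = <-irrefl (sym M≡a) (All.lookup a<B (∈-++⁺ʳ p (here refl)))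
    ... | inj₂ (there M∈p) = M∉p M∈p
    left-neighbour : ∀ p s → All (a <_) (p ++ M ∷ s) → 2 ≤ length (p ++ M ∷ s) →
                     L (A ++ a ∷ p) ⊔ headD s ≡ L p ⊔ headD s
    left-neighbour (c ∷ cs) s        _   _ = cong (_⊔ headD s) (L-++-∷ A a (λ ()))
    left-neighbour []       []       _   (s≤s ())
    left-neighbour []       (d ∷ ds) a<B _ =
      trans (cong (_⊔ d) (L-++ A a [])) (m≤n⇒m⊔n≡n (<⇒≤ (All.lookup a<B (there (here refl)))))

record AndISplit (v : List ℕ) (m : ℕ) (v′ : List ℕ) : Set where
  field
    min<   : All (m <_) (v ++ v′)
    andIˡ  : AndI v
    andIʳ  : AndI v′
    max∈ʳ  : (v ++ v′ ≡ []) ⊎ (∃[ x ] (x ∈ v′ × All (_≤ x) (v ++ v′)))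

  minL≡ : minL (v ++ m ∷ v′) ≡ m
  minL≡ = minL-∷ v v′ (All.++⁻ˡ v min<) (All.++⁻ʳ v min<)

  m∉v : m ∉ v
  m∉v = <-all⇒∉ (All.++⁻ˡ v min<)

data MinSplit : List ℕ → Set where
  minSplit : ∀ {v m v′} → AndISplit v m v′ → MinSplit (v ++ m ∷ v′)

splitAtMin : ∀ {t} → AndI t → t ≢ [] → MinSplit t
splitAtMin andI-[]                    t≢[] = ⊥-elim (t≢[] refl)
splitAtMin (andI-single x)            _    =
  minSplit {[]} {x} {[]} (record { min< = [] ; andIˡ = andI-[] ; andIʳ = andI-[] ; max∈ʳ = inj₁ refl })
splitAtMin (andI-split m< andIˡ andIʳ max) _ =
  minSplit (record { min< = m< ; andIˡ = andIˡ ; andIʳ = andIʳ ; max∈ʳ = inj₂ max })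

AndISplit⇒AndI : ∀ {v m v′} → AndISplit v m v′ → AndI (v ++ m ∷ v′)
AndISplit⇒AndI {v} {m} {v′} sp with AndISplit.max∈ʳ sp
... | inj₂ max = andI-split (AndISplit.min< sp) (AndISplit.andIˡ sp) (AndISplit.andIʳ sp) max
... | inj₁ vv′≡[] with ++-conicalˡ v v′ vv′≡[] | ++-conicalʳ v v′ vv′≡[]
...   | refl | refl = andI-single m

AndI-last : ∀ {w} → AndI w → w ≢ [] → L w ≡ maxL w
AndI-last andI-[]          w≢[] = ⊥-elim (w≢[] refl)
AndI-last (andI-single x)  _    = sym (⊔-identityʳ x)
AndI-last (andI-split {v} {m} {c ∷ cs} m< _ andIʳ (x , x∈ , ≤x)) _ = begin
  L (v ++ m ∷ c ∷ cs)    ≡⟨ L-++-∷ v m (λ ()) ⟩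
  L (c ∷ cs)             ≡⟨ AndI-last andIʳ (λ ()) ⟩
  maxL (c ∷ cs)          ≡⟨ maxL-≡ x∈ (All.++⁻ʳ v ≤x) ⟩
  x                      ≡⟨ sym (maxL-≡ (∈-++⁺ʳ v (there x∈)) (All.++⁺ (All.++⁻ˡ v ≤x) (m≤x ∷ All.++⁻ʳ v ≤x))) ⟩
  maxL (v ++ m ∷ c ∷ cs) ∎
  where
    open ≡-Reasoning
    m≤x = <⇒≤ (All.lookup m< (∈-++⁺ʳ v x∈))

record Factors (a : ℕ) (t₁ t₂ : List ℕ) : Set where
  field
    andI₁  : AndI t₁
    andI₂  : AndI t₂
    a<t₁   : All (a <_) t₁
    a<t₂   : All (a <_) t₂
    min∈t₂ : minL t₂ ∈ t₂
    min<t₁ : All (minL t₂ <_) t₁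

  min≤t₂ : All (minL t₂ ≤_) t₂
  min≤t₂ = All.tabulate minL-≤

  t₂≢[] : t₂ ≢ []
  t₂≢[] refl with min∈t₂
  ... | ()

-- The form of w is recovered from its parts: it is (i) exactly when max t₁ < max t₂.
assemble : ℕ → List ℕ → List ℕ → List ℕ
assemble a t₁ t₂ with maxL t₁ <? maxL t₂
... | yes _ = proj₁ (splitOn (minL t₂) t₂) ++ a ∷ t₁ ++ minL t₂ ∷ proj₂ (splitOn (minL t₂) t₂)
... | no  _ = t₂ ++ a ∷ t₁

assemble-i : ∀ {a t₁ v₀ b v₂} → AndISplit v₀ b v₂ → maxL t₁ < maxL (v₀ ++ b ∷ v₂) →
             assemble a t₁ (v₀ ++ b ∷ v₂) ≡ v₀ ++ a ∷ t₁ ++ b ∷ v₂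
assemble-i {a} {t₁} {v₀} {b} {v₂} sp max< with maxL t₁ <? maxL (v₀ ++ b ∷ v₂)
... | no max≮ = ⊥-elim (max≮ max<)
... | yes _ rewrite AndISplit.minL≡ sp | splitOn-mid v₀ v₂ (AndISplit.m∉v sp) = refl

assemble-ii : ∀ {a t₁ t₂} → maxL t₂ ≤ maxL t₁ → assemble a t₁ t₂ ≡ t₂ ++ a ∷ t₁
assemble-ii {a} {t₁} {t₂} max≤ with maxL t₁ <? maxL t₂
... | yes max< = ⊥-elim (<⇒≱ max< max≤)
... | no _     = refl

data Assembly (a : ℕ) (t₁ : List ℕ) : List ℕ → List ℕ → Set where
  form-i  : ∀ {v₀ b v₂} → AndISplit v₀ b v₂ → maxL t₁ < maxL (v₀ ++ b ∷ v₂) →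
            Assembly a t₁ (v₀ ++ b ∷ v₂) (v₀ ++ a ∷ t₁ ++ b ∷ v₂)
  form-ii : ∀ {t₂} → maxL t₂ ≤ maxL t₁ → Assembly a t₁ t₂ (t₂ ++ a ∷ t₁)

assembly : ∀ {a t₁ t₂} → Factors a t₁ t₂ → Assembly a t₁ t₂ (assemble a t₁ t₂)
assembly {a} {t₁} {t₂} fs with maxL t₁ <? maxL t₂
... | no max≮ = form-ii (≮⇒≥ max≮)
... | yes max< with splitAtMin (Factors.andI₂ fs) (Factors.t₂≢[] fs)
...   | minSplit {v₀} {b} {v₂} sp rewrite AndISplit.minL≡ sp | splitOn-mid v₀ v₂ (AndISplit.m∉v sp) =
  form-i sp max<

module FormI {a t₁ v₀ b v₂} (fs : Factors a t₁ (v₀ ++ b ∷ v₂)) (sp : AndISplit v₀ b v₂) where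
  open Factors fs public
  open AndISplit sp public

  b<t₁ : All (b <_) t₁
  b<t₁ = subst (λ c → All (c <_) t₁) minL≡ min<t₁

  b<v₀ : All (b <_) v₀
  b<v₀ = All.++⁻ˡ v₀ min<

  b<v₂ : All (b <_) v₂
  b<v₂ = All.++⁻ʳ v₀ min<

  a<v₀ : All (a <_) v₀
  a<v₀ = All.++⁻ˡ v₀ a<t₂

  a<b : a < b
  a<b = All.head (All.++⁻ʳ v₀ a<t₂)

  a<v₂ : All (a <_) v₂
  a<v₂ = All.tail (All.++⁻ʳ v₀ a<t₂)

  a<t₁bv₂ : All (a <_) (t₁ ++ b ∷ v₂)
  a<t₁bv₂ = All.++⁺ a<t₁ (a<b ∷ a<v₂)

module FormII {a t₁ t₂} (fs : Factors a t₁ t₂) (max≤ : maxL t₂ ≤ maxL t₁) where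
  open Factors fs public

  t₂≤max₁ : All (_≤ maxL t₁) t₂
  t₂≤max₁ = All.tabulate (λ x∈ → ≤-trans (∈⇒≤maxL x∈) max≤)

  t₁≢[] : t₁ ≢ []
  t₁≢[] refl = <⇒≱ (All.lookup a<t₂ min∈t₂) (≤-trans (All.lookup t₂≤max₁ min∈t₂) z≤n)

2≰1 : ¬ 2 ≤ 1
2≰1 (s≤s ())

length-∷-pos : ∀ xs (a : ℕ) ys → 1 ≤ length (xs ++ a ∷ ys)
length-∷-pos []      _ _ = s≤s z≤n
length-∷-pos (_ ∷ _) _ _ = s≤s z≤n

length-∷-∷ : ∀ xs (a : ℕ) ys b zs → 2 ≤ length (xs ++ a ∷ ys ++ b ∷ zs)
length-∷-∷ []       a ys b zs = s≤s (length-∷-pos ys b zs)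
length-∷-∷ (_ ∷ xs) a ys b zs = m≤n⇒m≤1+n (length-∷-∷ xs a ys b zs)

φ'-[] : ∀ f → φ' f [] ≡ []
φ'-[] zero    = refl
φ'-[] (suc f) = refl

φ'-[_] : ∀ f x → φ' f [ x ] ≡ [ x ]
φ'-[ zero  ] x = refl
φ'-[ suc f ] x = refl

φ'-unfold : ∀ f w {a₁ p a₂ b q} → 3 ≤ length w →
            minL w ≡ a₁ → splitOn a₁ w ≡ p → minL (proj₁ p ++ proj₂ p) ≡ a₂ →
            any (_≡ᵇ a₂) (proj₂ p) ≡ b → splitOn a₂ (proj₂ p) ≡ q →
            φ' (suc f) w ≡ (if b then φ' f (proj₁ q) ++ a₁ ∷ φ' f (proj₁ p ++ a₂ ∷ proj₂ q)
                                 else φ' f (proj₂ p) ++ a₁ ∷ φ' f (proj₁ p))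
φ'-unfold f (_ ∷ _ ∷ _ ∷ _) _                  refl refl refl refl refl = refl
φ'-unfold f (_ ∷ [])        (s≤s ())
φ'-unfold f (_ ∷ _ ∷ [])    (s≤s (s≤s ()))

φ-step-i-≥3 : ∀ f {a t₁ v₀ b v₂} → Factors a t₁ (v₀ ++ b ∷ v₂) → AndISplit v₀ b v₂ →
              3 ≤ length (v₀ ++ a ∷ t₁ ++ b ∷ v₂) →
              φ' (suc f) (v₀ ++ a ∷ t₁ ++ b ∷ v₂) ≡ φ' f t₁ ++ a ∷ φ' f (v₀ ++ b ∷ v₂)
φ-step-i-≥3 f {a} {t₁} {v₀} {b} {v₂} fs sp 3≤ =
  φ'-unfold f (v₀ ++ a ∷ t₁ ++ b ∷ v₂) 3≤ (minL-∷ v₀ _ a<v₀ a<t₁bv₂) (splitOn-mid v₀ _ (<-all⇒∉ a<v₀)) minL≡b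
    (any-≡ᵇ-∈ (∈-++⁺ʳ t₁ (here refl))) (splitOn-mid t₁ v₂ (<-all⇒∉ b<t₁))
  where
    open FormI fs sp
    minL≡b : minL (v₀ ++ t₁ ++ b ∷ v₂) ≡ b
    minL≡b = minL-≡ (∈-++⁺ʳ v₀ (∈-++⁺ʳ t₁ (here refl)))
      (All.++⁺ (<-all⇒≤-all b<v₀) (All.++⁺ (<-all⇒≤-all b<t₁) (≤-refl ∷ <-all⇒≤-all b<v₂)))

φ-step-i : ∀ f {a t₁ v₀ b v₂} → Factors a t₁ (v₀ ++ b ∷ v₂) → AndISplit v₀ b v₂ →
           φ' (suc f) (v₀ ++ a ∷ t₁ ++ b ∷ v₂) ≡ φ' f t₁ ++ a ∷ φ' f (v₀ ++ b ∷ v₂)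
φ-step-i f {t₁ = []}    {[]}     {b} {[]}    fs sp rewrite φ'-[] f | φ'-[ f ] b = refl
φ-step-i f {a} {t₁}     {_ ∷ v₀} {b} {v₂}    fs sp = φ-step-i-≥3 f fs sp (s≤s (length-∷-∷ v₀ a t₁ b v₂))
φ-step-i f {t₁ = _ ∷ t₁} {[]}    {b} {v₂}    fs sp = φ-step-i-≥3 f fs sp (s≤s (s≤s (length-∷-pos t₁ b v₂)))
φ-step-i f {t₁ = []}    {[]}     {b} {_ ∷ _} fs sp = φ-step-i-≥3 f fs sp (s≤s (s≤s (s≤s z≤n)))

φ-step-ii : ∀ f {a t₁ t₂} → Factors a t₁ t₂ → maxL t₂ ≤ maxL t₁ →
            φ' (suc f) (t₂ ++ a ∷ t₁) ≡ φ' f t₁ ++ a ∷ φ' f t₂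
φ-step-ii f {t₁ = []}             fs max≤ = ⊥-elim (FormII.t₁≢[] fs max≤ refl)
φ-step-ii f {t₁ = _ ∷ _} {[]}     fs max≤ = ⊥-elim (Factors.t₂≢[] fs refl)
φ-step-ii f {a} {y ∷ t₁} {x ∷ t₂} fs max≤ =
  φ'-unfold f (x ∷ t₂ ++ a ∷ y ∷ t₁) (s≤s (length-∷-∷ t₂ a [] y t₁)) (minL-∷ (x ∷ t₂) (y ∷ t₁) a<t₂ a<t₁)
    (splitOn-mid (x ∷ t₂) (y ∷ t₁) (<-all⇒∉ a<t₂)) minL≡min₂ (any-≡ᵇ-∉ (<-all⇒∉ min<t₁)) refl
  where
    open FormII fs max≤
    minL≡min₂ : minL ((x ∷ t₂) ++ y ∷ t₁) ≡ minL (x ∷ t₂)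
    minL≡min₂ = minL-≡ (∈-++⁺ˡ min∈t₂) (All.++⁺ min≤t₂ (<-all⇒≤-all min<t₁))

φ-assemble : ∀ f {a t₁ t₂} → Factors a t₁ t₂ → φ' (suc f) (assemble a t₁ t₂) ≡ φ' f t₁ ++ a ∷ φ' f t₂
φ-assemble f {a} {t₁} {t₂} fs with assemble a t₁ t₂ | assembly fs
... | _ | form-i sp _   = φ-step-i f fs sp
... | _ | form-ii max≤ = φ-step-ii f fs max≤

assemble-↭ : ∀ {a t₁ t₂} → Factors a t₁ t₂ → assemble a t₁ t₂ ↭ t₁ ++ a ∷ t₂
assemble-↭ {a} {t₁} {t₂} fs with assemble a t₁ t₂ | assembly fs
... | _ | form-i {v₀} {b} {v₂} _ _ = ↭-trans (shifts v₀ (a ∷ t₁)) (↭-sym (shift a t₁ (v₀ ++ b ∷ v₂)))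
... | _ | form-ii _ = ↭-trans (shift a t₂ t₁) (↭-trans (↭.prep a (++-comm t₂ t₁)) (↭-sym (shift a t₁ t₂)))

<-all-maxL<⇒[] : ∀ {b xs} → All (b <_) xs → maxL xs < b → xs ≡ []
<-all-maxL<⇒[] []           _      = refl
<-all-maxL<⇒[] (b<x ∷ b<xs) max<b = ⊥-elim (<-asym b<x (≤-<-trans (m≤m⊔n _ _) max<b))

AndI-form-i : ∀ {a t₁ v₀ b v₂} → Factors a t₁ (v₀ ++ b ∷ v₂) → AndISplit v₀ b v₂ →
              maxL t₁ < maxL (v₀ ++ b ∷ v₂) → AndI (v₀ ++ a ∷ t₁ ++ b ∷ v₂)
AndI-form-i {a} {t₁} {v₀} {b} {v₂} fs sp max< = andI-i max∈ʳ
  where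
    open FormI fs sp
    andI-i : (v₀ ++ v₂ ≡ []) ⊎ (∃[ z ] (z ∈ v₂ × All (_≤ z) (v₀ ++ v₂))) → AndI (v₀ ++ a ∷ t₁ ++ b ∷ v₂)
    andI-i (inj₁ v₀v₂≡[]) with ++-conicalˡ v₀ v₂ v₀v₂≡[] | ++-conicalʳ v₀ v₂ v₀v₂≡[]
    ... | refl | refl with <-all-maxL<⇒[] b<t₁ (subst (maxL t₁ <_) (⊔-identityʳ b) max<)
    ...   | refl = andI-split (a<b ∷ []) andI-[] (andI-single b) (b , here refl , ≤-refl ∷ [])
    andI-i (inj₂ (z , z∈v₂ , ≤z)) =
      andI-split (All.++⁺ a<v₀ a<t₁bv₂) andIˡ
        (andI-split (All.++⁺ b<t₁ b<v₂) andI₁ andIʳ (z , z∈v₂ , All.++⁺ t₁≤z v₂≤z))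
        (z , ∈-++⁺ʳ t₁ (there z∈v₂) , All.++⁺ v₀≤z (All.++⁺ t₁≤z (b≤z ∷ v₂≤z)))
      where
        v₀≤z = All.++⁻ˡ v₀ ≤z
        v₂≤z = All.++⁻ʳ v₀ ≤z
        b≤z  = <⇒≤ (All.lookup b<v₂ z∈v₂)
        t₁≤z : All (_≤ z) t₁
        t₁≤z = All.tabulate (λ x∈ → ≤-trans (∈⇒≤maxL x∈)
                 (<⇒≤ (<-≤-trans max< (maxL-lub (All.++⁺ v₀≤z (b≤z ∷ v₂≤z))))))

AndI-form-ii : ∀ {a t₁ t₂} → Factors a t₁ t₂ → maxL t₂ ≤ maxL t₁ → AndI (t₂ ++ a ∷ t₁)
AndI-form-ii {t₁ = []} fs max≤ = ⊥-elim (FormII.t₁≢[] fs max≤ refl)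
AndI-form-ii {t₁ = _ ∷ _} fs max≤ =
  andI-split (All.++⁺ a<t₂ a<t₁) andI₂ andI₁ (_ , maxL-∈ , All.++⁺ t₂≤max₁ (All.tabulate ∈⇒≤maxL))
  where open FormII fs max≤

assemble-AndI : ∀ {a t₁ t₂} → Factors a t₁ t₂ → AndI (assemble a t₁ t₂)
assemble-AndI {a} {t₁} {t₂} fs with assemble a t₁ t₂ | assembly fs
... | _ | form-i sp max< = AndI-form-i fs sp max<
... | _ | form-ii max≤   = AndI-form-ii fs max≤

spi-assemble : ∀ {a t₁ t₂} → Factors a t₁ t₂ → spi (assemble a t₁ t₂) ≡ spi t₂
spi-assemble {a} {t₁} {t₂} fs with assemble a t₁ t₂ | assembly fs
... | _ | form-i {[]} {b} {v₂} sp _ = begin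
  spi (a ∷ t₁ ++ b ∷ v₂)  ≡⟨ spi-min-head (<-all⇒≤-all a<t₁bv₂) ⟩
  L (a ∷ t₁ ++ b ∷ v₂)    ≡⟨ L-++ (a ∷ t₁) b v₂ ⟩
  L (b ∷ v₂)              ≡⟨ sym (spi-min-head (<-all⇒≤-all b<v₂)) ⟩
  spi (b ∷ v₂)            ∎
  where
    open ≡-Reasoning
    open FormI fs sp
... | _ | form-i {x ∷ r} {b} {v₂} sp _ =
  trans (spi-cut r (t₁ ++ b ∷ v₂) (All.head a<v₀)) (sym (spi-cut r v₂ (All.head b<v₀)))
  where open FormI fs sp
... | _ | form-ii {[]} _    = ⊥-elim (Factors.t₂≢[] fs refl)
... | _ | form-ii {x ∷ r} _ = spi-cut r t₁ (All.head (Factors.a<t₂ fs))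

assemble-leading : ∀ {a t₁ t₂} → Factors a t₁ t₂ →
                   (∃[ s ] assemble a t₁ t₂ ≡ a ∷ s) ⊎ (∃₂ λ r s → assemble a t₁ t₂ ≡ F t₂ ∷ r ++ a ∷ s)
assemble-leading {a} {t₁} {t₂} fs with assemble a t₁ t₂ | assembly fs
... | _ | form-i {[]}    {b} {v₂} _ _ = inj₁ (t₁ ++ b ∷ v₂ , refl)
... | _ | form-i {x ∷ r} {b} {v₂} _ _ = inj₂ (r , t₁ ++ b ∷ v₂ , refl)
... | _ | form-ii {[]} _              = ⊥-elim (Factors.t₂≢[] fs refl)
... | _ | form-ii {x ∷ r} _           = inj₂ (r , t₁ , refl)

data Decomposed : List ℕ → Set where
  empty     : Decomposed []
  single    : ∀ x → Decomposed [ x ]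
  assembled : ∀ {a t₁ t₂} → Factors a t₁ t₂ → Decomposed (assemble a t₁ t₂)

decompose-pair : ∀ {m m′} → m < m′ → Decomposed (m ∷ m′ ∷ [])
decompose-pair {m} {m′} m<m′ = subst Decomposed (assemble-i sp max<) (assembled fs)
  where
    fs : Factors m [] [ m′ ]
    fs = record { andI₁ = andI-[] ; andI₂ = andI-single m′ ; a<t₁ = [] ; a<t₂ = m<m′ ∷ []
                ; min∈t₂ = here refl ; min<t₁ = [] }
    sp : AndISplit [] m′ []
    sp = record { min< = [] ; andIˡ = andI-[] ; andIʳ = andI-[] ; max∈ʳ = inj₁ refl }
    max< : maxL [] < maxL [ m′ ]
    max< = subst (0 <_) (sym (⊔-identityʳ m′)) (≤-trans (s≤s z≤n) m<m′)

decompose-i : ∀ {v m y m′ y′ x} → All (m <_) (v ++ y ++ m′ ∷ y′) → AndI v → AndISplit y m′ y′ →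
              All (m′ <_) v → x ∈ y ++ m′ ∷ y′ → All (_≤ x) (v ++ y ++ m′ ∷ y′) →
              Unique (v ++ m ∷ y ++ m′ ∷ y′) → Decomposed (v ++ m ∷ y ++ m′ ∷ y′)
decompose-i {v} {m} {y} {m′} {y′} {x} m< andI-v sp m′<v x∈ ≤x w! with AndISplit.max∈ʳ sp
... | inj₁ yy′≡[] with ++-conicalˡ y y′ yy′≡[] | ++-conicalʳ y y′ yy′≡[] | x∈
...   | refl | refl | here refl with v | m′<v | All.++⁻ˡ v ≤x
...     | []    | _           | _           = decompose-pair (All.head m<)
...     | _ ∷ _ | m′<q ∷ _   | q≤m′ ∷ _    = ⊥-elim (<⇒≱ m′<q q≤m′)
decompose-i {v} {m} {y} {m′} {y′} {x} m< andI-v sp m′<v x∈ ≤x w! | inj₂ (z , z∈y′ , ≤z) =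
  subst Decomposed (assemble-i sp′ max<) (assembled fs)
  where
    open AndISplit sp
    x≤z : x ≤ z
    x≤z with ∈-++⁻ y x∈
    ... | inj₁ x∈y          = All.lookup (All.++⁻ˡ y ≤z) x∈y
    ... | inj₂ (here refl)  = <⇒≤ (All.lookup (All.++⁻ʳ y min<) z∈y′)
    ... | inj₂ (there x∈y′) = All.lookup (All.++⁻ʳ y ≤z) x∈y′
    v≤z : All (_≤ z) v
    v≤z = All.map (λ q≤x → ≤-trans q≤x x≤z) (All.++⁻ˡ v ≤x)
    sp′ : AndISplit v m′ y′
    sp′ = record { min< = All.++⁺ m′<v (All.++⁻ʳ y min<) ; andIˡ = andI-v ; andIʳ = andIʳ
                 ; max∈ʳ = inj₂ (z , z∈y′ , All.++⁺ v≤z (All.++⁻ʳ y ≤z)) }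
    m<ym′y′ = All.++⁻ʳ v m<
    fs : Factors m y (v ++ m′ ∷ y′)
    fs = record
      { andI₁ = andIˡ ; andI₂ = AndISplit⇒AndI sp′
      ; a<t₁ = All.++⁻ˡ y m<ym′y′ ; a<t₂ = All.++⁺ (All.++⁻ˡ v m<) (All.++⁻ʳ y m<ym′y′)
      ; min∈t₂ = subst (_∈ v ++ m′ ∷ y′) (sym (AndISplit.minL≡ sp′)) (∈-++⁺ʳ v (here refl))
      ; min<t₁ = subst (λ c → All (c <_) y) (sym (AndISplit.minL≡ sp′)) (All.++⁻ˡ y min<) }
    ym′y′! : Unique (y ++ m′ ∷ y′)
    ym′y′! = AllPairs.tail (Unique-++⁻ʳ v w!)
    y<z : All (_< z) y
    y<z = All.tabulate λ {q} q∈y → ≤∧≢⇒< (All.lookup (All.++⁻ˡ y ≤z) q∈y)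
      (λ { refl → Unique-++-disjoint y ym′y′! q∈y (there z∈y′) })
    max< : maxL y < maxL (v ++ m′ ∷ y′)
    max< = <-≤-trans (maxL-<-lub (≤-<-trans z≤n (All.lookup min< (∈-++⁺ʳ y z∈y′))) y<z)
                     (∈⇒≤maxL (∈-++⁺ʳ v (there z∈y′)))

decompose-ii : ∀ {v m v′ x} → All (m <_) (v ++ v′) → AndI v → AndI v′ → x ∈ v′ → All (_≤ x) (v ++ v′) →
               ¬ All (minL v′ <_) v → Unique (v ++ m ∷ v′) → Decomposed (v ++ m ∷ v′)
decompose-ii {v} {m} {v′} m< andI-v andI-v′ x∈ ≤x min′≮v w!
  with find (¬All⇒Any¬ (minL v′ <?_) v min′≮v)
... | e , e∈v , min′≮e = subst Decomposed (assemble-ii max≤) (assembled fs)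
  where
    max≤ : maxL v ≤ maxL v′
    max≤ = ≤-trans (maxL-lub (All.++⁻ˡ v ≤x)) (∈⇒≤maxL x∈)
    min<v′ : All (minL v <_) v′
    min<v′ = All.tabulate λ {q} q∈ →
      ≤∧≢⇒< (≤-trans (minL-≤ e∈v) (≤-trans (≮⇒≥ min′≮e) (minL-≤ q∈)))
            (λ { refl → Unique-++-disjoint v w! (∈⇒minL-∈ e∈v) (there q∈) })
    fs : Factors m v′ v
    fs = record { andI₁ = andI-v′ ; andI₂ = andI-v ; a<t₁ = All.++⁻ʳ v m< ; a<t₂ = All.++⁻ˡ v m<
                ; min∈t₂ = ∈⇒minL-∈ e∈v ; min<t₁ = min<v′ }

decompose : ∀ {w} → AndI w → Unique w → Decomposed w
decompose andI-[]          _ = empty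
decompose (andI-single x)  _ = single x
decompose (andI-split {v} {m} {v′} m< andI-v andI-v′ (x , x∈ , ≤x)) w!
  with All.all? (minL v′ <?_) v
... | no min≮v = decompose-ii m< andI-v andI-v′ x∈ ≤x min≮v w!
... | yes min<v with splitAtMin andI-v′ (∈⇒≢[] x∈)
...   | minSplit sp = decompose-i m< andI-v sp (subst (λ c → All (c <_) v) (AndISplit.minL≡ sp) min<v) x∈ ≤x w!

-- Fuel f suffices for φ' f and pit' f to compute φ and pit on w.
record Admissible (f : ℕ) (w : List ℕ) : Set where
  field
    fits   : length w ≤ f
    andI   : AndI w
    unique : Unique w

open Admissible

length-split : ∀ {f} t₁ (a : ℕ) t₂ → length (t₁ ++ a ∷ t₂) ≤ suc f → length t₁ ≤ f × length t₂ ≤ f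
length-split {f} t₁ a t₂ len = ≤-trans (m≤m+n _ _) len′ , ≤-trans (m≤n+m _ _) len′
  where
    len′ : length t₁ + length t₂ ≤ f
    len′ = s≤s⁻¹ (subst (_≤ suc f) (trans (length-++ t₁) (+-suc (length t₁) (length t₂))) len)

parts-admissible : ∀ {f a t₁ t₂} → Factors a t₁ t₂ → Admissible (suc f) (assemble a t₁ t₂) →
                   Admissible f t₁ × Admissible f t₂
parts-admissible {a = a} {t₁} {t₂} fs adm =
    record { fits = proj₁ lengths ; andI = andI₁ ; unique = Unique-++⁻ˡ t₁ parts! }
  , record { fits = proj₂ lengths ; andI = andI₂ ; unique = AllPairs.tail (Unique-++⁻ʳ t₁ parts!) }
  where
    open Factors fs
    parts! : Unique (t₁ ++ a ∷ t₂)
    parts! = Unique-resp-↭ (↭⇒↭ₛ (assemble-↭ fs)) (unique adm)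
    lengths = length-split t₁ a t₂ (subst (_≤ _) (↭-length (assemble-↭ fs)) (fits adm))

φ-↭ : ∀ f {w} → Admissible f w → φ' f w ↭ w
φ-↭ zero    _   = ↭.refl
φ-↭ (suc f) adm with decompose (andI adm) (unique adm)
... | empty    = ↭.refl
... | single _ = ↭.refl
... | assembled {a} {t₁} {t₂} fs =
  ↭-trans (↭.↭-reflexive (φ-assemble f fs))
    (↭-trans (↭-++⁺ (φ-↭ f adm₁) (↭.prep a (φ-↭ f adm₂))) (↭-sym (assemble-↭ fs)))
  where
    adm₁ = proj₁ (parts-admissible fs adm)
    adm₂ = proj₂ (parts-admissible fs adm)

module Image {f a t₁ t₂} (fs : Factors a t₁ t₂) (adm₁ : Admissible f t₁) (adm₂ : Admissible f t₂) where
  open Factors fs public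

  a<φ₁ : All (a <_) (φ' f t₁)
  a<φ₁ = All-resp-↭ (↭-sym (φ-↭ f adm₁)) a<t₁

  a<φ₂ : All (a <_) (φ' f t₂)
  a<φ₂ = All-resp-↭ (↭-sym (φ-↭ f adm₂)) a<t₂

  min<φ₁ : All (minL t₂ <_) (φ' f t₁)
  min<φ₁ = All-resp-↭ (↭-sym (φ-↭ f adm₁)) min<t₁

  min≤φ₂ : All (minL t₂ ≤_) (φ' f t₂)
  min≤φ₂ = All-resp-↭ (↭-sym (φ-↭ f adm₂)) min≤t₂

  min∈φ₂ : minL t₂ ∈ φ' f t₂
  min∈φ₂ = ∈-resp-↭ (↭-sym (φ-↭ f adm₂)) min∈t₂

  φ₂≢[] : φ' f t₂ ≢ []
  φ₂≢[] = ∈⇒≢[] min∈φ₂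

  maxL-φ₁ : maxL (φ' f t₁) ≡ maxL t₁
  maxL-φ₁ = maxL-↭ (φ-↭ f adm₁)

  maxL-φ₂ : maxL (φ' f t₂) ≡ maxL t₂
  maxL-φ₂ = maxL-↭ (φ-↭ f adm₂)

  minL-image : minL (φ' f t₁ ++ a ∷ φ' f t₂) ≡ a
  minL-image = minL-∷ (φ' f t₁) (φ' f t₂) a<φ₁ a<φ₂

  splitOn-image : splitOn a (φ' f t₁ ++ a ∷ φ' f t₂) ≡ (φ' f t₁ , φ' f t₂)
  splitOn-image = splitOn-mid (φ' f t₁) (φ' f t₂) (<-all⇒∉ a<φ₁)

φ-AndII : ∀ f {w} → Admissible f w → AndII (φ' f w)
φ-AndII zero    {[]}    _   = andII-[]
φ-AndII zero    {_ ∷ _} adm with fits adm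
... | ()
φ-AndII (suc f) adm with decompose (andI adm) (unique adm)
... | empty    = andII-[]
... | single x = andII-single x
... | assembled {a} {t₁} {t₂} fs =
  subst AndII (sym (φ-assemble f fs))
    (andII-split (All.++⁺ a<φ₁ a<φ₂) (φ-AndII f adm₁) (φ-AndII f adm₂)
                 (minL t₂ , min∈φ₂ , All.++⁺ (<-all⇒≤-all min<φ₁) min≤φ₂))
  where
    adm₁ = proj₁ (parts-admissible fs adm)
    adm₂ = proj₂ (parts-admissible fs adm)
    open Image fs adm₁ adm₂

φ-length : ∀ f {w} → Admissible f w → length (φ' f w) ≡ length w
φ-length f adm = ↭-length (φ-↭ f adm)

assemble-length : ∀ {a t₁ t₂} → Factors a t₁ t₂ → 2 ≤ length (assemble a t₁ t₂)
assemble-length {t₂ = []}             fs = ⊥-elim (Factors.t₂≢[] fs refl)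
assemble-length {a} {t₁} {c ∷ cs} fs = subst (2 ≤_) (sym (↭-length (assemble-↭ fs))) (length-∷-∷ t₁ a [] c cs)

short≢image : ∀ {f a t₁ t₂ u} → Factors a t₁ t₂ → Admissible (suc f) (assemble a t₁ t₂) →
              length u ≤ 1 → u ≢ φ' (suc f) (assemble a t₁ t₂)
short≢image {f} fs adm len≤1 u≡ = 2≰1 (≤-trans 2≤u len≤1)
  where
    2≤u = subst (2 ≤_) (sym (trans (cong length u≡) (φ-length (suc f) adm))) (assemble-length fs)

-- a and a′ are both the minimum of the common image, which therefore splits at a = a′.
assembled-injective : ∀ {f a t₁ t₂ a′ t₁′ t₂′} → Factors a t₁ t₂ → Factors a′ t₁′ t₂′ →
  Admissible f t₁ × Admissible f t₂ → Admissible f t₁′ × Admissible f t₂′ →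
  (∀ {u u′} → Admissible f u → Admissible f u′ → φ' f u ≡ φ' f u′ → u ≡ u′) →
  φ' f t₁ ++ a ∷ φ' f t₂ ≡ φ' f t₁′ ++ a′ ∷ φ' f t₂′ → assemble a t₁ t₂ ≡ assemble a′ t₁′ t₂′
assembled-injective {f} {a} {t₁} {t₂} fs fs′ (adm₁ , adm₂) (adm₁′ , adm₂′) φ-injective-f eq
  with trans (sym (Image.minL-image fs adm₁ adm₂)) (trans (cong minL eq) (Image.minL-image fs′ adm₁′ adm₂′))
... | refl with ∷-split-injective _ _ _ _ (<-all⇒∉ (Image.a<φ₁ fs adm₁ adm₂))
                                         (<-all⇒∉ (Image.a<φ₁ fs′ adm₁′ adm₂′)) eq
...   | φ₁≡ , φ₂≡ = cong₂ (assemble a) (φ-injective-f adm₁ adm₁′ φ₁≡) (φ-injective-f adm₂ adm₂′ φ₂≡)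

φ-injective : ∀ f {w w′} → Admissible f w → Admissible f w′ → φ' f w ≡ φ' f w′ → w ≡ w′
φ-injective zero    _   _    eq = eq
φ-injective (suc f) adm adm′ eq with decompose (andI adm) (unique adm) | decompose (andI adm′) (unique adm′)
... | empty          | empty          = refl
... | single _       | single _       = eq
... | empty          | single _       = ⊥-elim (∈⇒≢[] (here refl) (sym eq))
... | single _       | empty          = ⊥-elim (∈⇒≢[] (here refl) eq)
... | empty          | assembled fs′  = ⊥-elim (short≢image fs′ adm′ z≤n eq)
... | single _       | assembled fs′  = ⊥-elim (short≢image fs′ adm′ (s≤s z≤n) eq)
... | assembled fs   | empty          = ⊥-elim (short≢image fs adm z≤n (sym eq))
... | assembled fs   | single _       = ⊥-elim (short≢image fs adm (s≤s z≤n) (sym eq))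
... | assembled fs   | assembled fs′  =
  assembled-injective fs fs′ (parts-admissible fs adm) (parts-admissible fs′ adm′) (φ-injective f)
    (trans (sym (φ-assemble f fs)) (trans eq (φ-assemble f fs′)))

record Preimage (u : List ℕ) : Set where
  field
    word  : List ℕ
    andIʷ : AndI word
    ↭u    : word ↭ u
    maps  : ∀ f → length word ≤ f → φ' f word ≡ u

φ-surjective : ∀ {u} → AndII u → Unique u → Preimage u
φ-surjective andII-[]         _ =
  record { word = [] ; andIʷ = andI-[] ; ↭u = ↭.refl ; maps = λ f _ → φ'-[] f }
φ-surjective (andII-single x) _ =
  record { word = [ x ] ; andIʷ = andI-single x ; ↭u = ↭.refl ; maps = λ f _ → φ'-[ f ] x }
φ-surjective (andII-split {p} {m} {q} m< andII-p andII-q (y , y∈q , y≤)) u! = record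
  { word  = assemble m t₁ t₂
  ; andIʷ = assemble-AndI fs
  ; ↭u    = ↭-trans (assemble-↭ fs) (↭-++⁺ t₁↭p (↭.prep m t₂↭q))
  ; maps  = maps
  }
  where
    q! : Unique q
    q! = AllPairs.tail (Unique-++⁻ʳ p u!)
    open Preimage (φ-surjective andII-p (Unique-++⁻ˡ p u!))
      renaming (word to t₁; andIʷ to andI-t₁; ↭u to t₁↭p; maps to maps₁)
    open Preimage (φ-surjective andII-q q!)
      renaming (word to t₂; andIʷ to andI-t₂; ↭u to t₂↭q; maps to maps₂)
    y<p : All (y <_) p
    y<p = All.tabulate λ {e} e∈p → ≤∧≢⇒< (All.lookup (All.++⁻ˡ p y≤) e∈p)
      (λ { refl → Unique-++-disjoint p u! e∈p (there y∈q) })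
    minL≡y : minL t₂ ≡ y
    minL≡y = minL-≡ (∈-resp-↭ (↭-sym t₂↭q) y∈q) (All-resp-↭ (↭-sym t₂↭q) (All.++⁻ʳ p y≤))
    fs : Factors m t₁ t₂
    fs = record
      { andI₁ = andI-t₁ ; andI₂ = andI-t₂
      ; a<t₁ = All-resp-↭ (↭-sym t₁↭p) (All.++⁻ˡ p m<) ; a<t₂ = All-resp-↭ (↭-sym t₂↭q) (All.++⁻ʳ p m<)
      ; min∈t₂ = subst (_∈ t₂) (sym minL≡y) (∈-resp-↭ (↭-sym t₂↭q) y∈q)
      ; min<t₁ = subst (λ c → All (c <_) t₁) (sym minL≡y) (All-resp-↭ (↭-sym t₁↭p) y<p) }
    maps : ∀ f → length (assemble m t₁ t₂) ≤ f → φ' f (assemble m t₁ t₂) ≡ p ++ m ∷ q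
    maps zero    len with ≤-trans (assemble-length fs) len
    ... | ()
    maps (suc f) len = trans (φ-assemble f fs) (cong₂ (λ l r → l ++ m ∷ r) (maps₁ f len₁) (maps₂ f len₂))
      where
        lengths = length-split t₁ m t₂ (subst (_≤ suc f) (↭-length (assemble-↭ fs)) len)
        len₁ = proj₁ lengths
        len₂ = proj₂ lengths

spi-L : ∀ f {w} → Admissible f w → w ≢ [] → spi w ≡ L (φ' f w)
spi-L zero    {[]}    _   w≢[] = ⊥-elim (w≢[] refl)
spi-L zero    {_ ∷ _} adm _    with fits adm
... | ()
spi-L (suc f) adm w≢[] with decompose (andI adm) (unique adm)
... | empty    = ⊥-elim (w≢[] refl)
... | single _ = refl
... | assembled {a} {t₁} {t₂} fs = begin
  spi (assemble a t₁ t₂)             ≡⟨ spi-assemble fs ⟩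
  spi t₂                             ≡⟨ spi-L f adm₂ t₂≢[] ⟩
  L (φ' f t₂)                        ≡⟨ sym (L-++-∷ (φ' f t₁) a φ₂≢[]) ⟩
  L (φ' f t₁ ++ a ∷ φ' f t₂)         ≡⟨ cong L (sym (φ-assemble f fs)) ⟩
  L (φ' (suc f) (assemble a t₁ t₂))  ∎
  where
    open ≡-Reasoning
    adm₁ = proj₁ (parts-admissible fs adm)
    adm₂ = proj₂ (parts-admissible fs adm)
    open Image fs adm₁ adm₂

spi≢L : ∀ {x a} r s → Unique (x ∷ r ++ a ∷ s) → a < x → spi (x ∷ r ++ a ∷ s) ≢ L (x ∷ r ++ a ∷ s)
spi≢L {x} {a} r s w! a<x spi≡L = Unique-++-disjoint (x ∷ r) w!
  (subst (_∈ x ∷ r) (sym (spi-cut r s a<x)) (spi-∈ x r))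
  (subst (_∈ a ∷ s) (sym (trans spi≡L (L-++ (x ∷ r) a s))) (L-∈ a s))

-- pit stops at once exactly when φ w ends with its maximum, i.e. when w starts with its minimum.
leading-cases : ∀ {a t₁ t₂} → Factors a t₁ t₂ → Unique (assemble a t₁ t₂) →
  (F (assemble a t₁ t₂) ≡ a × spi (assemble a t₁ t₂) ≡ maxL (assemble a t₁ t₂)) ⊎
  (F (assemble a t₁ t₂) ≡ F t₂ × spi (assemble a t₁ t₂) ≢ maxL (assemble a t₁ t₂))
leading-cases {a} {t₁} {t₂} fs w! with assemble a t₁ t₂ | assemble-leading fs | assemble-AndI fs | assemble-↭ fs
... | _ | inj₁ (s , refl) | andI-w | w↭ =
  inj₁ (refl , trans (spi-min-head a≤s) (AndI-last andI-w (λ ())))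
  where
    open Factors fs
    a≤s = All.tail (All-resp-↭ (↭-sym w↭) (All.++⁺ (<-all⇒≤-all a<t₁) (≤-refl ∷ <-all⇒≤-all a<t₂)))
... | _ | inj₂ (r , s , refl) | andI-w | _ =
  inj₂ (refl , λ spi≡max → spi≢L r s w! a<F₂ (trans spi≡max (sym (AndI-last andI-w (λ ())))))
  where
    open Factors fs
    a<F₂ = All.lookup a<t₂ (headD-∈ t₂≢[])

pit-step : ∀ f {a t₁ t₂} → Factors a t₁ t₂ → Admissible (suc f) (assemble a t₁ t₂) →
  pit' (suc f) (φ' (suc f) (assemble a t₁ t₂))
    ≡ (if spi (assemble a t₁ t₂) ≡ᵇ maxL (assemble a t₁ t₂) then a else pit' f (φ' f t₂))
pit-step f {a} {t₁} {t₂} fs adm = begin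
  pit' (suc f) (φ' (suc f) w)
    ≡⟨ cong (pit' (suc f)) (φ-assemble f fs) ⟩
  pit' (suc f) P
    ≡⟨ cong (λ m → if L P ≡ᵇ maxL P then m else pit' f (proj₂ (splitOn m P))) minL-image ⟩
  (if L P ≡ᵇ maxL P then a else pit' f (proj₂ (splitOn a P)))
    ≡⟨ cong₂ (λ b s → if b then a else pit' f s) (cong₂ _≡ᵇ_ L≡spi maxL≡) (cong proj₂ splitOn-image) ⟩
  (if spi w ≡ᵇ maxL w then a else pit' f (φ' f t₂))
    ∎
  where
    open ≡-Reasoning
    adm₁ = proj₁ (parts-admissible fs adm)
    adm₂ = proj₂ (parts-admissible fs adm)
    open Image fs adm₁ adm₂
    w = assemble a t₁ t₂
    P = φ' f t₁ ++ a ∷ φ' f t₂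
    L≡spi : L P ≡ spi w
    L≡spi = trans (L-++-∷ (φ' f t₁) a φ₂≢[]) (trans (sym (spi-L f adm₂ t₂≢[])) (sym (spi-assemble fs)))
    maxL≡ : maxL P ≡ maxL w
    maxL≡ = trans (cong maxL (sym (φ-assemble f fs))) (maxL-↭ (φ-↭ (suc f) adm))

F-pit : ∀ f {w} → Admissible f w → w ≢ [] → F w ≡ pit' f (φ' f w)
F-pit zero    {[]}    _   w≢[] = ⊥-elim (w≢[] refl)
F-pit zero    {_ ∷ _} adm _    with fits adm
... | ()
F-pit (suc f) adm w≢[] with decompose (andI adm) (unique adm)
... | empty    = ⊥-elim (w≢[] refl)
... | single x rewrite ⊔-identityʳ x | ≡ᵇ-true (refl {x = x}) = refl
... | assembled {a} {t₁} {t₂} fs with leading-cases fs (unique adm)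
...   | inj₁ (F≡a , spi≡max) = trans F≡a (sym (trans (pit-step f fs adm) (cong next (≡ᵇ-true spi≡max))))
  where next = λ b → if b then a else pit' f (φ' f t₂)
...   | inj₂ (F≡F₂ , spi≢max) = trans F≡F₂ (trans (F-pit f adm₂ (Factors.t₂≢[] fs))
                                    (sym (trans (pit-step f fs adm) (cong next (≡ᵇ-false spi≢max)))))
  where
    next = λ b → if b then a else pit' f (φ' f t₂)
    adm₂ = proj₂ (parts-admissible fs adm)

grn-pair : ∀ {a b} → a < b → grn (a ∷ b ∷ []) ≡ a
grn-pair {a} {b} a<b =
  trans (grn-split [ a ] b [] (maxL-≡ (there (here refl)) (<⇒≤ a<b ∷ ≤-refl ∷ []))
                   (λ { (here b≡a) → <-irrefl (sym b≡a) a<b }))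
        (⊔-identityʳ a)

grn-max-first : ∀ {c a xs} → maxL (c ∷ a ∷ xs) ≡ c → grn (c ∷ a ∷ xs) ≡ a
grn-max-first {c} {a} {xs} max≡c = grn-split [] c (a ∷ xs) max≡c (λ ())

NL-grn-i : ∀ {f a t₁ v₀ b v₂} → Factors a t₁ (v₀ ++ b ∷ v₂) → AndISplit v₀ b v₂ →
  maxL t₁ < maxL (v₀ ++ b ∷ v₂) → Admissible f t₁ → Admissible f (v₀ ++ b ∷ v₂) →
  (∀ {u} → Admissible f u → 2 ≤ length u → NL u ≡ grn (φ' f u)) →
  NL (v₀ ++ a ∷ t₁ ++ b ∷ v₂) ≡ grn (φ' f t₁ ++ a ∷ φ' f (v₀ ++ b ∷ v₂))
NL-grn-i {f} {a} {t₁} {v₀} {b} {[]} fs sp max< _ _ _ with AndISplit.max∈ʳ sp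
... | inj₂ (_ , () , _)
... | inj₁ v₀≡[] with ++-conicalˡ v₀ [] v₀≡[]
...   | refl with <-all-maxL<⇒[] (FormI.b<t₁ fs sp) (subst (maxL t₁ <_) (⊔-identityʳ b) max<)
...     | refl rewrite φ'-[] f | φ'-[ f ] b = sym (grn-pair (FormI.a<b fs sp))
NL-grn-i {f} {a} {t₁} {v₀} {b} {c ∷ cs} fs sp max< adm₁ adm₂ NL-grn-f = begin
  NL (v₀ ++ a ∷ t₁ ++ b ∷ c ∷ cs)  ≡⟨ NL-++ v₀ _ (length-∷-∷ [] a t₁ b (c ∷ cs)) ⟩
  NL (a ∷ t₁ ++ b ∷ c ∷ cs)        ≡⟨ NL-++ (a ∷ t₁) (b ∷ c ∷ cs) (s≤s (s≤s z≤n)) ⟩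
  NL (b ∷ c ∷ cs)                  ≡⟨ sym (NL-++ v₀ (b ∷ c ∷ cs) (s≤s (s≤s z≤n))) ⟩
  NL t₂                            ≡⟨ NL-grn-f adm₂ 2≤t₂ ⟩
  grn (φ' f t₂)                    ≡⟨ sym (grn-++ˡ (φ' f t₁) a M∈ refl maxP φ₁<M a<φ₂ 2≤φ₂) ⟩
  grn (φ' f t₁ ++ a ∷ φ' f t₂)     ∎
  where
    open ≡-Reasoning
    open Image fs adm₁ adm₂
    t₂ = v₀ ++ b ∷ c ∷ cs
    2≤t₂ = length-∷-∷ v₀ b [] c cs
    2≤φ₂ = subst (2 ≤_) (sym (φ-length f adm₂)) 2≤t₂
    M = maxL (φ' f t₂)
    M∈ : M ∈ φ' f t₂
    M∈ = ≢[]⇒maxL-∈ φ₂≢[]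
    φ₁<M : All (_< M) (φ' f t₁)
    φ₁<M = All.tabulate λ q∈ → ≤-<-trans (∈⇒≤maxL q∈)
      (subst₂ _<_ (sym maxL-φ₁) (sym maxL-φ₂) max<)
    maxP : maxL (φ' f t₁ ++ a ∷ φ' f t₂) ≡ M
    maxP = maxL-≡ (∈-++⁺ʳ (φ' f t₁) (there M∈))
      (All.++⁺ (All.map <⇒≤ φ₁<M) (<⇒≤ (<-≤-trans (All.lookup a<φ₂ M∈) ≤-refl) ∷ All.tabulate ∈⇒≤maxL))

NL-grn-ii : ∀ {f a t₁ t₂} → Factors a t₁ t₂ → maxL t₂ ≤ maxL t₁ → Admissible f t₁ → Admissible f t₂ →
  (∀ {u} → Admissible f u → 2 ≤ length u → NL u ≡ grn (φ' f u)) →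
  NL (t₂ ++ a ∷ t₁) ≡ grn (φ' f t₁ ++ a ∷ φ' f t₂)
NL-grn-ii {t₁ = []} fs max≤ _ _ _ = ⊥-elim (FormII.t₁≢[] fs max≤ refl)
NL-grn-ii {f} {a} {c ∷ []} {t₂} fs max≤ adm₁ adm₂ _ = begin
  NL (t₂ ++ a ∷ c ∷ [])           ≡⟨ NL-++ t₂ (a ∷ c ∷ []) (s≤s (s≤s z≤n)) ⟩
  a                               ≡⟨ sym (grn-max-first max≡c) ⟩
  grn (c ∷ a ∷ φ' f t₂)           ≡⟨ cong (λ l → grn (l ++ a ∷ φ' f t₂)) (sym (φ'-[ f ] c)) ⟩
  grn (φ' f [ c ] ++ a ∷ φ' f t₂) ∎
  where
    open ≡-Reasoning
    open Image fs adm₁ adm₂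
    φ₂≤c : All (_≤ c) (φ' f t₂)
    φ₂≤c = All.tabulate λ q∈ → ≤-trans (∈⇒≤maxL q∈)
      (≤-trans (≤-reflexive maxL-φ₂) (subst (maxL t₂ ≤_) (⊔-identityʳ c) max≤))
    max≡c : maxL (c ∷ a ∷ φ' f t₂) ≡ c
    max≡c = maxL-≡ (here refl) (≤-refl ∷ <⇒≤ (All.head a<t₁) ∷ φ₂≤c)
NL-grn-ii {f} {a} {t₁@(c ∷ d ∷ ds)} {t₂} fs max≤ adm₁ adm₂ NL-grn-f = begin
  NL (t₂ ++ a ∷ t₁)               ≡⟨ NL-++ t₂ (a ∷ t₁) (s≤s (s≤s z≤n)) ⟩
  NL (a ∷ t₁)                     ≡⟨ NL-++ [ a ] t₁ (s≤s (s≤s z≤n)) ⟩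
  NL t₁                           ≡⟨ NL-grn-f adm₁ (s≤s (s≤s z≤n)) ⟩
  grn (φ' f t₁)                   ≡⟨ sym (grn-++ʳ a (φ' f t₂) M∈ refl maxP a<φ₁ 2≤φ₁) ⟩
  grn (φ' f t₁ ++ a ∷ φ' f t₂)    ∎
  where
    open ≡-Reasoning
    open Image fs adm₁ adm₂
    2≤φ₁ = subst (2 ≤_) (sym (φ-length f adm₁)) (s≤s (s≤s z≤n))
    M = maxL (φ' f t₁)
    M∈ : M ∈ φ' f t₁
    M∈ = ≢[]⇒maxL-∈ (λ φ₁≡[] → 2≰1 (≤-trans (subst (λ l → 2 ≤ length l) φ₁≡[] 2≤φ₁) z≤n))
    φ₂≤M : All (_≤ M) (φ' f t₂)
    φ₂≤M = All.tabulate λ q∈ → ≤-trans (∈⇒≤maxL q∈) (subst₂ _≤_ (sym maxL-φ₂) (sym maxL-φ₁) max≤)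
    maxP : maxL (φ' f t₁ ++ a ∷ φ' f t₂) ≡ M
    maxP = maxL-≡ (∈-++⁺ˡ M∈) (All.++⁺ (All.tabulate ∈⇒≤maxL) (<⇒≤ (All.lookup a<φ₁ M∈) ∷ φ₂≤M))

NL-grn-step : ∀ {f a t₁ t₂} → Factors a t₁ t₂ → Admissible f t₁ × Admissible f t₂ →
  (∀ {u} → Admissible f u → 2 ≤ length u → NL u ≡ grn (φ' f u)) →
  NL (assemble a t₁ t₂) ≡ grn (φ' f t₁ ++ a ∷ φ' f t₂)
NL-grn-step {f} {a} {t₁} {t₂} fs (adm₁ , adm₂) NL-grn-f with assemble a t₁ t₂ | assembly fs
... | _ | form-i sp max< = NL-grn-i fs sp max< adm₁ adm₂ NL-grn-f
... | _ | form-ii max≤   = NL-grn-ii fs max≤ adm₁ adm₂ NL-grn-f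

NL-grn : ∀ f {w} → Admissible f w → 2 ≤ length w → NL w ≡ grn (φ' f w)
NL-grn zero    adm 2≤w with ≤-trans 2≤w (fits adm)
... | ()
NL-grn (suc f) adm 2≤w with decompose (andI adm) (unique adm)
... | empty    = ⊥-elim (2≰1 (≤-trans 2≤w z≤n))
... | single _ = ⊥-elim (2≰1 2≤w)
... | assembled fs =
  trans (NL-grn-step fs (parts-admissible fs adm) (NL-grn f)) (cong grn (sym (φ-assemble f fs)))

↭[1‥n]⇒Unique : ∀ {n w} → w ↭ [1‥ n ] → Unique w
↭[1‥n]⇒Unique {n} w↭ =
  Unique-resp-↭ (↭⇒↭ₛ (↭-sym w↭)) (applyUpTo⁺₁ suc n (λ i<j _ → <⇒≢ i<j ∘ suc-injective))

↭[1‥n]⇒length : ∀ {n w} → w ↭ [1‥ n ] → length w ≡ n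
↭[1‥n]⇒length {n} w↭ = trans (↭-length w↭) (length-applyUpTo suc n)

AndIn⇒Admissible : ∀ {n w} → AndIn n w → Admissible n w
AndIn⇒Admissible (w↭ , andI-w) =
  record { fits = ≤-reflexive (↭[1‥n]⇒length w↭) ; andI = andI-w ; unique = ↭[1‥n]⇒Unique w↭ }

φ≡φ'ⁿ : ∀ {n w} → AndIn n w → φ w ≡ φ' n w
φ≡φ'ⁿ {w = w} (w↭ , _) = cong (λ f → φ' f w) (↭[1‥n]⇒length w↭)

theorem3p3 : ∀ (n : ℕ) → 2 ≤ n →
    (∀ w → AndIn n w → AndIIn n (φ w))
    × (∀ w w' → AndIn n w → AndIn n w' → φ w ≡ φ w' → w ≡ w')
    × (∀ u → AndIIn n u → ∃[ w ] (AndIn n w × φ w ≡ u))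
    × (∀ w → AndIn n w →
         (F w ≡ pit (φ w)) × (spi w ≡ L (φ w)) × (NL w ≡ grn (φ w)))
theorem3p3 n 2≤n = image , injective , surjective , statistics
  where
    image : ∀ w → AndIn n w → AndIIn n (φ w)
    image w w∈@(w↭ , _) rewrite φ≡φ'ⁿ w∈ =
      ↭-trans (φ-↭ n (AndIn⇒Admissible w∈)) w↭ , φ-AndII n (AndIn⇒Admissible w∈)

    injective : ∀ w w′ → AndIn n w → AndIn n w′ → φ w ≡ φ w′ → w ≡ w′
    injective w w′ w∈ w′∈ eq = φ-injective n (AndIn⇒Admissible w∈) (AndIn⇒Admissible w′∈)
      (trans (sym (φ≡φ'ⁿ w∈)) (trans eq (φ≡φ'ⁿ w′∈)))

    surjective : ∀ u → AndIIn n u → ∃[ w ] (AndIn n w × φ w ≡ u)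
    surjective u (u↭ , andII-u) = word , (↭-trans ↭u u↭ , andIʷ) , maps (length word) ≤-refl
      where open Preimage (φ-surjective andII-u (↭[1‥n]⇒Unique u↭))

    statistics : ∀ w → AndIn n w → (F w ≡ pit (φ w)) × (spi w ≡ L (φ w)) × (NL w ≡ grn (φ w))
    statistics w w∈@(w↭ , _) rewrite φ≡φ'ⁿ w∈ =
        trans (F-pit n adm w≢[]) (cong (λ g → pit' g (φ' n w)) (sym length-φ≡n))
      , spi-L n adm w≢[]
      , NL-grn n adm 2≤w
      where
        adm = AndIn⇒Admissible w∈
        length-φ≡n = trans (φ-length n adm) (↭[1‥n]⇒length w↭)
        2≤w = subst (2 ≤_) (sym (↭[1‥n]⇒length w↭)) 2≤n
        w≢[] : w ≢ []
        w≢[] refl = 2≰1 (≤-trans 2≤w z≤n)
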